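{- Fix integers $k\ge 2$ and $1 \le t \le k/2$, and let $X$ be an $n$-element set. Any offline (non-adaptive) family of queries to a $(k,t)$ scale on $X$ which, for every total order on $X$, allows one to determine the order of $X \setminus (S\cup L)$ must contain at least $\binom{n}{k-(t-1)} \big/ \binom{k}{k-(t-1)}$ queries; in particular $\Omega(n^{k-t+1})$ queries are necessary for fixed $k,t$.
   Context: A $(k,t)$ scale accepts as input any $k$-element subset of a totally ordered set $X$ (distinct elements, order unknown to the user) and returns the $t$-th smallest element of that subset; using it on a set is a query. In the offline setting all queries must be specified in advance, before any answers are known. $S$ denotes the set of the $t-1$ smallest elements of $X$ and $L$ the set of the $k-t$ largest elements of $X$. -}

module Defs where

open import Data.Nat using (ℕ; _∸_; _≤_) renaming (_<_ to _<ℕ_)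
open import Data.Nat.Properties using (_<?_)
open import Data.Fin using (Fin; toℕ)
open import Data.Fin.Subset using (Subset; _∈_; _∩_; ∣_∣)
open import Data.Fin.Permutation using (Permutation′; _⟨$⟩ʳ_)
open import Data.Vec using (tabulate)
open import Data.Bool using (Bool)
open import Data.Product using (_×_)
open import Data.List using (List)
open import Data.List.Membership.Propositional using () renaming (_∈_ to _∈ₗ_)
open import Relation.Nullary using (¬_)
open import Relation.Nullary.Decidable using (⌊_⌋)
open import Function.Bundles using (_⇔_)
open import Relation.Binary.PropositionalEquality using (_≡_)

-- A total order on X = Fin n, given by its rank function:
-- (σ ⟨$⟩ʳ x) is the 0-based rank of x (0 = smallest).
Order : ℕ → Set
Order n = Permutation′ n

rank : ∀ {n} → Order n → Fin n → ℕ
rank σ x = toℕ (σ ⟨$⟩ʳ x)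

_<[_]_ : ∀ {n} → Fin n → Order n → Fin n → Set
x <[ σ ] y = rank σ x <ℕ rank σ y

belowIn : ∀ {n} → Order n → Subset n → Fin n → Subset n
belowIn σ Q x = Q ∩ tabulate (λ y → ⌊ rank σ y <? rank σ x ⌋)

-- x is the answer of a (k,t) scale to query Q under order σ:
-- x is the t-th smallest element of Q, i.e. x ∈ Q and exactly t-1
-- elements of Q are smaller than x.
ScaleAnswer : ∀ {n} (t : ℕ) → Order n → Subset n → Fin n → Set
ScaleAnswer t σ Q x = (x ∈ Q) × (∣ belowIn σ Q x ∣ ≡ (t ∸ 1))

-- S = the t-1 smallest elements of X, L = the k-t largest elements of X
InS : ∀ {n} (t : ℕ) → Order n → Fin n → Set
InS t σ x = rank σ x <ℕ (t ∸ 1)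

InL : ∀ {n} (k t : ℕ) → Order n → Fin n → Set
InL {n} k t σ x = n ∸ (k ∸ t) ≤ rank σ x

InMiddle : ∀ {n} (k t : ℕ) → Order n → Fin n → Set
InMiddle k t σ x = ¬ InS t σ x × ¬ InL k t σ x

SameAnswers : ∀ {n} (t : ℕ) → List (Subset n) → Order n → Order n → Set
SameAnswers {n} t Qs σ τ =
  ∀ Q → Q ∈ₗ Qs → ∀ (x : Fin n) → ScaleAnswer t σ Q x ⇔ ScaleAnswer t τ Q x

DeterminesMiddle : ∀ {n} (k t : ℕ) → List (Subset n) → Set
DeterminesMiddle {n} k t Qs =
  ∀ (σ τ : Order n) → SameAnswers t Qs σ τ →
    (∀ (x : Fin n) → InMiddle k t σ x ⇔ InMiddle k t τ x) ×
    (∀ (x y : Fin n) → InMiddle k t σ x → InMiddle k t σ y →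
       (x <[ σ ] y) ⇔ (x <[ τ ] y))

-- Let r = k - (t - 1).  If every r-subset of X lies in some query, double
-- counting the pairs (T, Q) with T ⊆ Q gives  n C r ≤ #queries · (k C r).
-- So suppose some r-subset T lies in no query.  Put T on top of an order σ
-- and let τ swap the two lowest elements a, c of T.  A query Q ⊉ T never
-- answers an element x of T: the elements of Q not below x lie in Q ∩ T,
-- which has fewer than r elements, so at least t elements of Q lie below x.
-- Off T the two orders coincide, so every query gets the same answer under
-- σ and τ.  Yet a, of rank n - r in σ, lies in X ∖ (S ∪ L) under σ and in L
-- under τ.
module Submission where

open import Level using (0ℓ)
open import Defs
open import Data.Nat using (ℕ; zero; suc; _+_; _*_; _∸_; _≤_; _<_; z≤n; s≤s; s≤s⁻¹)
open import Data.Nat.Properties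
  using ( _<?_; module ≤-Reasoning; ≤-reflexive; ≤-trans; <-≤-trans; <⇒≤; n≤1+n; ≮⇒≥; <⇒≱
        ; 1+n≰n; m<m+n; m<n⇒0<n∸m; +-suc; +-mono-≤; +-monoʳ-≤; +-monoʳ-<; +-∸-assoc
        ; m∸n≤m; ∸-monoˡ-≤; ∸-monoʳ-<; m+[n∸m]≡n; m∸[m∸n]≡n; +-commutativeSemigroup)
open import Algebra.Properties.CommutativeSemigroup +-commutativeSemigroup
  using (interchange; x∙yz≈y∙xz)
open import Data.Nat.Combinatorics using (_C_; nCk+nC[k+1]≡[n+1]C[k+1])
open import Data.Nat.ListAction using (sum)
open import Data.Fin using (Fin; zero; suc; toℕ; fromℕ<; punchIn; _≟_)
open import Data.Fin.Properties using (toℕ-fromℕ<; ¬∀⟶∃¬)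
open import Data.Fin.Subset
  using (Subset; Side; inside; outside; _∈_; _∉_; _⊆_; _⊂_; ∣_∣; _∩_; ∁; ⊥)
open import Data.Fin.Subset.Properties
  using ( _∈?_; _⊆?_; drop-there; drop-∷-⊆; ∣p∣≤n; ∣⊥∣≡0; x∈p∩q⁺; x∈p∩q⁻
        ; x∈∁p⇒x∉p; p⊆q⇒∣p∣≤∣q∣; p⊂q⇒∣p∣<∣q∣)
open import Data.Fin.Permutation
  using (_⟨$⟩ʳ_; _⟨$⟩ˡ_; _∘ₚ_; id; lift₀; insert; transpose; inverseʳ)
import Data.Fin.Permutation.Components as PC
open import Data.Vec using ([]; _∷_; here; there; tail; tabulate)
open import Data.Vec.Properties using (tabulate-cong)
open import Data.List using (List; []; _∷_; map; length)
open import Data.List.Membership.Propositional using (lose)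
open import Data.List.Relation.Unary.All as All using (All; []; _∷_)
open import Data.List.Relation.Unary.Any as Any using (Any; any?)
open import Data.List.Relation.Unary.Any.Properties using (map⁺)
open import Data.Product using (Σ; _,_; proj₁; proj₂)
open import Data.Empty using (⊥-elim)
open import Function.Base using (_∘_; case_of_)
open import Function.Bundles using (_⇔_; mk⇔; Equivalence)
open import Function.Properties.Equivalence
  using (⇔-setoid) renaming (refl to ⇔-refl; sym to ⇔-sym; trans to ⇔-trans)
open import Relation.Nullary using (¬_; Dec; yes; no; contradiction)
open import Relation.Nullary.Decidable
  using (⌊_⌋; does-⇔; isYes≗does; _→-dec_; decidable-stable)
open import Relation.Unary using (Pred; Decidable)
open import Relation.Binary.PropositionalEquality

open Equivalence using (to; from)

private
  variable
    n : ℕ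

suc∈∷⇔∈ : ∀ {s : Side} {p : Subset n} {y} → suc y ∈ s ∷ p ⇔ y ∈ p
suc∈∷⇔∈ = mk⇔ drop-there there

s≤s⇔≤ : ∀ {m k} → suc m ≤ suc k ⇔ m ≤ k
s≤s⇔≤ = mk⇔ s≤s⁻¹ s≤s

toℕ≤punchIn⇔toℕ≤ : ∀ (i : Fin (suc n)) j → toℕ i ≤ toℕ (punchIn i j) ⇔ toℕ i ≤ toℕ j
toℕ≤punchIn⇔toℕ≤ zero j = mk⇔ (λ _ → z≤n) (λ _ → z≤n)
toℕ≤punchIn⇔toℕ≤ (suc i) zero = mk⇔ (λ ()) (λ ())
toℕ≤punchIn⇔toℕ≤ (suc i) (suc j) = ⇔-trans s≤s⇔≤ (⇔-trans (toℕ≤punchIn⇔toℕ≤ i j) (⇔-sym s≤s⇔≤))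

∣p∩q∣+∣p∩∁q∣≡∣p∣ : ∀ (p q : Subset n) → ∣ p ∩ q ∣ + ∣ p ∩ ∁ q ∣ ≡ ∣ p ∣
∣p∩q∣+∣p∩∁q∣≡∣p∣ [] [] = refl
∣p∩q∣+∣p∩∁q∣≡∣p∣ (outside ∷ p) (_ ∷ q) = ∣p∩q∣+∣p∩∁q∣≡∣p∣ p q
∣p∩q∣+∣p∩∁q∣≡∣p∣ (inside ∷ p) (inside ∷ q) = cong suc (∣p∩q∣+∣p∩∁q∣≡∣p∣ p q)
∣p∩q∣+∣p∩∁q∣≡∣p∣ (inside ∷ p) (outside ∷ q) =
  trans (+-suc ∣ p ∩ q ∣ ∣ p ∩ ∁ q ∣) (cong suc (∣p∩q∣+∣p∩∁q∣≡∣p∣ p q))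

⊈⇒∩⊂ : ∀ {p q : Subset n} → ¬ p ⊆ q → q ∩ p ⊂ p
⊈⇒∩⊂ {n} {p} {q} p⊈q
  with y , ¬[y∈p→y∈q] ← ¬∀⟶∃¬ n _ (λ y → y ∈? p →-dec y ∈? q) (λ h → p⊈q (h _)) =
  (λ y∈q∩p → proj₂ (x∈p∩q⁻ q p y∈q∩p)) , y , y∈p , y∉q∩p
  where
  y∈p : y ∈ p
  y∈p = decidable-stable (y ∈? p) (λ y∉p → ¬[y∈p→y∈q] (λ y∈p → contradiction y∈p y∉p))
  y∉q∩p : y ∉ q ∩ p
  y∉q∩p y∈q∩p = ¬[y∈p→y∈q] (λ _ → proj₁ (x∈p∩q⁻ q p y∈q∩p))

-- Defs uses ⌊_⌋ = isYes, which does not reduce like does on open terms.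
⌊⌋-⇔ : ∀ {A B : Set} → A ⇔ B → (a? : Dec A) (b? : Dec B) → ⌊ a? ⌋ ≡ ⌊ b? ⌋
⌊⌋-⇔ A⇔B a? b? = trans (isYes≗does a?) (trans (does-⇔ A⇔B a? b?) (sym (isYes≗does b?)))

∈tabulate⇔ : ∀ {P : Pred (Fin n) 0ℓ} (P? : Decidable P) {y} → y ∈ tabulate (λ z → ⌊ P? z ⌋) ⇔ P y
∈tabulate⇔ P? {zero} with P? zero
... | yes Py = mk⇔ (λ _ → Py) (λ _ → here)
... | no ¬Py = mk⇔ (λ ()) (λ Py → contradiction Py ¬Py)
∈tabulate⇔ P? {suc y} = ⇔-trans suc∈∷⇔∈ (∈tabulate⇔ (P? ∘ suc))

transpose-matchˡ : ∀ (i j : Fin n) → PC.transpose i j i ≡ j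
transpose-matchˡ i j with i ≟ i
... | yes _ = refl
... | no i≢i = contradiction refl i≢i

transpose-other : ∀ {i j k : Fin n} → k ≢ i → k ≢ j → PC.transpose i j k ≡ k
transpose-other {i = i} {j} {k} k≢i k≢j with k ≟ i
... | yes k≡i = contradiction k≡i k≢i
... | no _ with k ≟ j
...   | yes k≡j = contradiction k≡j k≢j
...   | no _ = refl

transpose-∈ : ∀ {i j k : Fin n} {p : Subset n} → i ∈ p → j ∈ p → k ∈ p → PC.transpose i j k ∈ p
transpose-∈ {i = i} {j} {k} i∈p j∈p k∈p with k ≟ i
... | yes _ = j∈p
... | no _ with k ≟ j
...   | yes _ = i∈p
...   | no _ = k∈p

Covers : ℕ → List (Subset n) → Set
Covers {n} r Qs = (T : Subset n) → ∣ T ∣ ≡ r → Any (T ⊆_) Qs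

∑C : ℕ → List (Subset n) → ℕ
∑C r Qs = sum (map (λ Q → ∣ Q ∣ C r) Qs)

tailsContaining0 : List (Subset (suc n)) → List (Subset n)
tailsContaining0 [] = []
tailsContaining0 ((outside ∷ Q) ∷ Qs) = tailsContaining0 Qs
tailsContaining0 ((inside ∷ Q) ∷ Qs) = Q ∷ tailsContaining0 Qs

∑C-pascal : ∀ r (Qs : List (Subset (suc n))) →
  ∑C (suc r) Qs ≡ ∑C r (tailsContaining0 Qs) + ∑C (suc r) (map tail Qs)
∑C-pascal r [] = refl
∑C-pascal r ((outside ∷ Q) ∷ Qs) rewrite ∑C-pascal r Qs =
  x∙yz≈y∙xz (∣ Q ∣ C suc r) (∑C r (tailsContaining0 Qs)) (∑C (suc r) (map tail Qs))
∑C-pascal r ((inside ∷ Q) ∷ Qs) rewrite ∑C-pascal r Qs | sym (nCk+nC[k+1]≡[n+1]C[k+1] ∣ Q ∣ r) =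
  interchange (∣ Q ∣ C r) (∣ Q ∣ C suc r) (∑C r (tailsContaining0 Qs)) (∑C (suc r) (map tail Qs))

covers-tails : ∀ {r} (Qs : List (Subset (suc n))) → Covers r Qs → Covers r (map tail Qs)
covers-tails Qs cov T ∣T∣≡r = map⁺ (Any.map ⊆-tail (cov (outside ∷ T) ∣T∣≡r))
  where
  ⊆-tail : ∀ {Q : Subset (suc _)} → outside ∷ T ⊆ Q → T ⊆ tail Q
  ⊆-tail {_ ∷ _} = drop-∷-⊆

covers-tailsContaining0 : ∀ {r} (Qs : List (Subset (suc n))) →
  Covers (suc r) Qs → Covers r (tailsContaining0 Qs)
covers-tailsContaining0 Qs cov T ∣T∣≡r = go Qs (cov (inside ∷ T) (cong suc ∣T∣≡r))
  where
  go : (Qs : List (Subset (suc _))) → Any (inside ∷ T ⊆_) Qs → Any (T ⊆_) (tailsContaining0 Qs)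
  go ((outside ∷ Q) ∷ Qs) (Any.here T⊆Q) with () ← T⊆Q here
  go ((inside ∷ Q) ∷ Qs) (Any.here T⊆Q) = Any.here (drop-∷-⊆ T⊆Q)
  go ((outside ∷ Q) ∷ Qs) (Any.there p) = go Qs p
  go ((inside ∷ Q) ∷ Qs) (Any.there p) = Any.there (go Qs p)

C≤∑C : ∀ n r (Qs : List (Subset n)) → Covers r Qs → n C r ≤ ∑C r Qs
C≤∑C n zero [] cov with () ← cov ⊥ (∣⊥∣≡0 n)
C≤∑C n zero (_ ∷ _) cov = s≤s z≤n
C≤∑C zero (suc r) Qs cov = z≤n
C≤∑C (suc n) (suc r) Qs cov =
  subst₂ _≤_ (nCk+nC[k+1]≡[n+1]C[k+1] n r) (sym (∑C-pascal r Qs))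
    (+-mono-≤ (C≤∑C n r _ (covers-tailsContaining0 Qs cov))
              (C≤∑C n (suc r) _ (covers-tails Qs cov)))

∑C-uniform : ∀ {k} r (Qs : List (Subset n)) → All (λ Q → ∣ Q ∣ ≡ k) Qs →
  ∑C r Qs ≡ length Qs * (k C r)
∑C-uniform r [] [] = refl
∑C-uniform r (Q ∷ Qs) (refl ∷ ∣Qs∣≡k) = cong (∣ Q ∣ C r +_) (∑C-uniform r Qs ∣Qs∣≡k)

record OnTop {n} (σ : Order n) (T : Subset n) : Set where
  constructor onTop
  field
    ∈⇔threshold≤rank : ∀ y → y ∈ T ⇔ n ∸ ∣ T ∣ ≤ rank σ y

open OnTop

orderOnTop : (T : Subset n) → Σ (Order n) (λ σ → OnTop σ T)
orderOnTop [] = id , onTop λ ()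
orderOnTop {suc n} (outside ∷ T) with σ , onTop σ-top ← orderOnTop T = lift₀ σ , onTop top
  where
  open import Relation.Binary.Reasoning.Setoid (⇔-setoid 0ℓ)
  threshold : suc n ∸ ∣ T ∣ ≡ suc (n ∸ ∣ T ∣)
  threshold = +-∸-assoc 1 (∣p∣≤n T)
  top : ∀ y → y ∈ outside ∷ T ⇔ suc n ∸ ∣ T ∣ ≤ rank (lift₀ σ) y
  top zero = mk⇔ (λ ()) λ le → case subst (_≤ 0) threshold le of λ ()
  top (suc y) = begin
    suc y ∈ outside ∷ T                       ≈⟨ suc∈∷⇔∈ ⟩
    y ∈ T                                     ≈⟨ σ-top y ⟩
    n ∸ ∣ T ∣ ≤ rank σ y                      ≈⟨ s≤s⇔≤ ⟨
    suc (n ∸ ∣ T ∣) ≤ suc (rank σ y)          ≡⟨ cong (_≤ suc (rank σ y)) threshold ⟨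
    suc n ∸ ∣ T ∣ ≤ rank (lift₀ σ) (suc y)    ∎
orderOnTop {suc n} (inside ∷ T) with σ , onTop σ-top ← orderOnTop T = insert zero m σ , onTop top
  -- 0 gets rank n ∸ ∣ T ∣; punchIn moves the ranks of σ at or above it up by one.
  where
  open import Relation.Binary.Reasoning.Setoid (⇔-setoid 0ℓ)
  m : Fin (suc n)
  m = fromℕ< (s≤s (m∸n≤m n ∣ T ∣))
  toℕ-m : toℕ m ≡ n ∸ ∣ T ∣
  toℕ-m = toℕ-fromℕ< _
  top : ∀ y → y ∈ inside ∷ T ⇔ n ∸ ∣ T ∣ ≤ rank (insert zero m σ) y
  top zero = mk⇔ (λ _ → ≤-reflexive (sym toℕ-m)) (λ _ → here)
  top (suc y) = begin
    suc y ∈ inside ∷ T                           ≈⟨ suc∈∷⇔∈ ⟩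
    y ∈ T                                        ≈⟨ σ-top y ⟩
    n ∸ ∣ T ∣ ≤ rank σ y                         ≡⟨ cong (_≤ rank σ y) toℕ-m ⟨
    toℕ m ≤ rank σ y                             ≈⟨ toℕ≤punchIn⇔toℕ≤ m (σ ⟨$⟩ʳ y) ⟨
    toℕ m ≤ rank (insert zero m σ) (suc y)       ≡⟨ cong (_≤ rank (insert zero m σ) (suc y)) toℕ-m ⟩
    n ∸ ∣ T ∣ ≤ rank (insert zero m σ) (suc y)   ∎

rank-⟨$⟩ˡ-fromℕ< : ∀ (σ : Order n) {m} (m<n : m < n) → rank σ (σ ⟨$⟩ˡ fromℕ< m<n) ≡ m
rank-⟨$⟩ˡ-fromℕ< σ m<n = trans (cong toℕ (inverseʳ σ)) (toℕ-fromℕ< m<n)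

module _ {σ : Order n} {T : Subset n} (σ-top : OnTop σ T)
         {a c : Fin n} (a∈T : a ∈ T) (c∈T : c ∈ T) where

  onTop-transpose : OnTop (transpose a c ∘ₚ σ) T
  onTop-transpose =
    onTop λ y → ⇔-trans (∈⇔transpose∈ y) (σ-top .∈⇔threshold≤rank (PC.transpose a c y))
    where
    ∈⇔transpose∈ : ∀ y → y ∈ T ⇔ PC.transpose a c y ∈ T
    ∈⇔transpose∈ y = mk⇔ (transpose-∈ a∈T c∈T)
      (λ h → subst (_∈ T) (PC.transpose-inverse c a) (transpose-∈ c∈T a∈T h))

  rank-transpose-offTop : ∀ y → y ∉ T → rank (transpose a c ∘ₚ σ) y ≡ rank σ y
  rank-transpose-offTop y y∉T =
    cong (rank σ) (transpose-other (y∉T ∘ ∈-resp a∈T) (y∉T ∘ ∈-resp c∈T))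
    where
    ∈-resp : ∀ {z} → z ∈ T → y ≡ z → y ∈ T
    ∈-resp z∈T refl = z∈T

  rank-transpose-a : rank (transpose a c ∘ₚ σ) a ≡ rank σ c
  rank-transpose-a = cong (rank σ) (transpose-matchˡ a c)

module _ {σ : Order n} {T : Subset n} (σ-top : OnTop σ T) where

  ∣Q∣<∣belowIn∣+∣T∣ : ∀ {Q x} → ¬ T ⊆ Q → x ∈ T → ∣ Q ∣ < ∣ belowIn σ Q x ∣ + ∣ T ∣
  ∣Q∣<∣belowIn∣+∣T∣ {Q} {x} T⊈Q x∈T = begin-strict
    ∣ Q ∣                                  ≡⟨ ∣p∩q∣+∣p∩∁q∣≡∣p∣ Q below ⟨
    ∣ belowIn σ Q x ∣ + ∣ Q ∩ ∁ below ∣    ≤⟨ +-monoʳ-≤ ∣ belowIn σ Q x ∣ (p⊆q⇒∣p∣≤∣q∣ notBelow⊆T) ⟩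
    ∣ belowIn σ Q x ∣ + ∣ Q ∩ T ∣          <⟨ +-monoʳ-< ∣ belowIn σ Q x ∣ (p⊂q⇒∣p∣<∣q∣ (⊈⇒∩⊂ T⊈Q)) ⟩
    ∣ belowIn σ Q x ∣ + ∣ T ∣              ∎
    where
    open ≤-Reasoning
    below : Subset n
    below = tabulate (λ y → ⌊ rank σ y <? rank σ x ⌋)
    notBelow⊆T : Q ∩ ∁ below ⊆ Q ∩ T
    notBelow⊆T {y} y∈ with y∈Q , y∈∁below ← x∈p∩q⁻ Q (∁ below) y∈ =
      x∈p∩q⁺ (y∈Q , from (σ-top .∈⇔threshold≤rank y)
                      (≤-trans (to (σ-top .∈⇔threshold≤rank x) x∈T) x≤y))
      where
      x≤y : rank σ x ≤ rank σ y
      x≤y = ≮⇒≥ (x∈∁p⇒x∉p y∈∁below ∘ from (∈tabulate⇔ (λ z → rank σ z <? rank σ x)))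

  ¬ScaleAnswer-top : ∀ {t Q x} → ¬ T ⊆ Q → (t ∸ 1) + ∣ T ∣ ≤ ∣ Q ∣ → x ∈ T → ¬ ScaleAnswer t σ Q x
  ¬ScaleAnswer-top {Q = Q} T⊈Q large x∈T (_ , ∣below∣≡t∸1) =
    <⇒≱ (∣Q∣<∣belowIn∣+∣T∣ T⊈Q x∈T) (subst (λ b → b + ∣ T ∣ ≤ ∣ Q ∣) (sym ∣below∣≡t∸1) large)

  top≮offTop : ∀ {x y} → y ∈ T → x ∉ T → ¬ rank σ y < rank σ x
  top≮offTop y∈T x∉T y<x =
    x∉T (from (σ-top .∈⇔threshold≤rank _) (≤-trans (to (σ-top .∈⇔threshold≤rank _) y∈T) (<⇒≤ y<x)))

module _ {σ τ : Order n} {T : Subset n} (σ-top : OnTop σ T) (τ-top : OnTop τ T)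
         (agree : ∀ y → y ∉ T → rank τ y ≡ rank σ y) where

  belowIn-offTop : ∀ {Q x} → x ∉ T → belowIn σ Q x ≡ belowIn τ Q x
  belowIn-offTop {Q} {x} x∉T = cong (Q ∩_) (tabulate-cong λ y → ⌊⌋-⇔ (comparison y) _ _)
    where
    comparison : ∀ y → rank σ y < rank σ x ⇔ rank τ y < rank τ x
    comparison y with y ∈? T
    ... | yes y∈T = mk⇔ (λ y<x → ⊥-elim (top≮offTop σ-top y∈T x∉T y<x))
                        (λ y<x → ⊥-elim (top≮offTop τ-top y∈T x∉T y<x))
    ... | no y∉T rewrite agree y y∉T | agree x x∉T = ⇔-refl

  scaleAnswer-offTop⇔ : ∀ {t Q} → ¬ T ⊆ Q → (t ∸ 1) + ∣ T ∣ ≤ ∣ Q ∣ →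
    ∀ x → ScaleAnswer t σ Q x ⇔ ScaleAnswer t τ Q x
  scaleAnswer-offTop⇔ {t} {Q} T⊈Q large x with x ∈? T
  ... | yes x∈T = mk⇔ (λ ans → ⊥-elim (¬ScaleAnswer-top σ-top {t} T⊈Q large x∈T ans))
                      (λ ans → ⊥-elim (¬ScaleAnswer-top τ-top {t} T⊈Q large x∈T ans))
  ... | no x∉T rewrite belowIn-offTop {Q} x∉T = ⇔-refl

uncovered⇒¬DeterminesMiddle : ∀ {k t r} (Qs : List (Subset n)) (T : Subset n) → ∣ T ∣ ≡ r →
  ¬ Any (T ⊆_) Qs → All (λ Q → (t ∸ 1) + r ≤ ∣ Q ∣) Qs →
  t ∸ 1 ≤ n ∸ r → n ∸ (k ∸ t) ≡ suc (n ∸ r) → suc (n ∸ r) < n →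
  ¬ DeterminesMiddle k t Qs
uncovered⇒¬DeterminesMiddle {n} {k} {t} Qs T refl uncovered large t∸1≤n∸r L≡ c<n determines =
  proj₂ (to (proj₁ (determines σ τ same) a) a-middle-in-σ) a-in-L-in-τ
  where
  σ = proj₁ (orderOnTop T)
  σ-top = proj₂ (orderOnTop T)
  p = n ∸ ∣ T ∣
  a = σ ⟨$⟩ˡ fromℕ< (<⇒≤ c<n)
  c = σ ⟨$⟩ˡ fromℕ< c<n
  rank-a : rank σ a ≡ p
  rank-a = rank-⟨$⟩ˡ-fromℕ< σ (<⇒≤ c<n)
  rank-c : rank σ c ≡ suc p
  rank-c = rank-⟨$⟩ˡ-fromℕ< σ c<n
  a∈T : a ∈ T
  a∈T = from (σ-top .∈⇔threshold≤rank a) (≤-reflexive (sym rank-a))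
  c∈T : c ∈ T
  c∈T = from (σ-top .∈⇔threshold≤rank c) (≤-trans (n≤1+n p) (≤-reflexive (sym rank-c)))
  τ = transpose a c ∘ₚ σ
  same : SameAnswers t Qs σ τ
  same Q Q∈Qs = scaleAnswer-offTop⇔ σ-top (onTop-transpose σ-top a∈T c∈T)
    (rank-transpose-offTop σ-top a∈T c∈T) {t} (uncovered ∘ lose Q∈Qs) (All.lookup large Q∈Qs)
  a-middle-in-σ : InMiddle k t σ a
  a-middle-in-σ = (λ a∈S → <⇒≱ a∈S (subst (t ∸ 1 ≤_) (sym rank-a) t∸1≤n∸r))
                , (λ a∈L → 1+n≰n (subst₂ _≤_ L≡ rank-a a∈L))
  a-in-L-in-τ : InL k t τ a
  a-in-L-in-τ = ≤-reflexive (trans L≡ (sym (trans (rank-transpose-a σ-top a∈T c∈T) rank-c)))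

mainTheorem3 : (k t n : ℕ) → 2 ≤ k → 1 ≤ t → 2 * t ≤ k → k ≤ n →
    (Qs : List (Subset n)) → All (λ Q → ∣ Q ∣ ≡ k) Qs →
    DeterminesMiddle k t Qs →
    n C (k ∸ (t ∸ 1)) ≤ length Qs * (k C (k ∸ (t ∸ 1)))
mainTheorem3 k (suc u) n _ _ 2t≤k k≤n Qs ∣Qs∣≡k determines =
  subst (n C r ≤_) (∑C-uniform r Qs ∣Qs∣≡k) (C≤∑C n r Qs covered)
  where
  r = k ∸ u
  t<k : suc u < k
  t<k = <-≤-trans (m<m+n (suc u) (s≤s z≤n)) 2t≤k
  u≤k : u ≤ k
  u≤k = ≤-trans (n≤1+n u) (<⇒≤ t<k)
  r≡1+[k∸t] : r ≡ suc (k ∸ suc u)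
  r≡1+[k∸t] = +-∸-assoc 1 (<⇒≤ t<k)
  1+[k∸t]≤n : suc (k ∸ suc u) ≤ n
  1+[k∸t]≤n = subst (_≤ n) r≡1+[k∸t] (≤-trans (m∸n≤m k u) k≤n)
  L≡ : n ∸ (k ∸ suc u) ≡ suc (n ∸ r)
  L≡ = trans (+-∸-assoc 1 1+[k∸t]≤n) (cong (λ m → suc (n ∸ m)) (sym r≡1+[k∸t]))
  covered : Covers r Qs
  covered T ∣T∣≡r with any? (T ⊆?_) Qs
  ... | yes T⊆Q = T⊆Q
  ... | no uncovered = ⊥-elim (uncovered⇒¬DeterminesMiddle {k = k} {suc u} Qs T ∣T∣≡r uncovered
    (All.map (λ ∣Q∣≡k → ≤-reflexive (trans (m+[n∸m]≡n u≤k) (sym ∣Q∣≡k))) ∣Qs∣≡k)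
    (subst (_≤ n ∸ r) (m∸[m∸n]≡n u≤k) (∸-monoˡ-≤ r k≤n))
    L≡
    (subst (_< n) L≡ (∸-monoʳ-< (m<n⇒0<n∸m t<k) (≤-trans (n≤1+n _) 1+[k∸t]≤n)))
    determines)
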